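{- Let $\alpha,\beta$ be non-negative integers with $n=2^{\alpha}3^{\beta}>12$ and $n\ne 24$. Then $$\varphi_{12}(n)=\begin{cases} \frac12\left(3^{\beta-2}-(-1)^{\alpha+\beta}\right), & \text{if } \alpha=0, \text{ or } \alpha=1 \text{ and } \beta\ge 2;\\[2pt] 2^{\alpha-2}\cdot 3^{\beta-2}, & \text{if } \alpha\ge 2 \text{ and } \beta\ge 2;\\[2pt] \frac13\left(2^{\alpha+\beta-3}+(-1)^{\alpha+\beta}\right), & \text{if } \alpha\ge 4 \text{ and } \beta\in\{0,1\}. \end{cases}$$
   Context: For positive integers $n,e$, the generalized Euler function is $\varphi_e(n)=\#\{i\in\mathbb{Z}: 1\le i\le \lfloor n/e\rfloor,\ \gcd(i,n)=1\}$, where $\lfloor x\rfloor$ is the greatest integer not exceeding $x$. -}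

module Defs where

open import Data.Nat using (ℕ; suc; NonZero; _≟_)
open import Data.Nat.DivMod using (_/_)
open import Data.Nat.GCD using (gcd)
open import Data.List using (List; length; filter; map; upTo)
open import Data.Integer using (ℤ; -_; +_) renaming (_^_ to _^ℤ_)

φ : (e : ℕ) → .{{NonZero e}} → ℕ → ℕ
φ e n = length (filter (λ i → gcd i n ≟ 1) (map suc (upTo (n / e))))

neg1^ : ℕ → ℤ
neg1^ k = (- (+ 1)) ^ℤ k

{-# OPTIONS --safe #-}
-- Whether i is coprime to n = 2^α·3^β depends only on which of 2, 3 divide n, i.e. on
-- d ∈ {2, 3, 6}; and the number of i ∈ [1, m] coprime to d grows by exactly φ(d) over
-- every block of d consecutive integers. Hence φ₁₂(n) is that count for m = ⌊n/12⌋, which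
-- is read off from n = r + 12m. In the cases with a sign, m is determined by the residue of
-- 3^β mod 4 (resp. 2^α mod 3), and that residue is (-1)^β (resp. (-1)^α), since 3 ≡ -1 (mod 4)
-- and 2 ≡ -1 (mod 3).
module Submission where

open import Defs
open import Data.Nat using (ℕ; _+_; _*_; _∸_; _^_; _≤_; _<_)
open import Data.Integer using (ℤ; +_) renaming (_+_ to _+ℤ_; _-_ to _-ℤ_; _*_ to _*ℤ_)
open import Data.Product using (_×_)
open import Data.Sum using (_⊎_)
open import Relation.Binary.PropositionalEquality using (_≡_; _≢_)

open import Data.Nat using (zero; suc; s≤s; _≟_; _<?_; NonZero)
open import Data.Nat.Properties using (+-identityʳ; +-comm; +-suc; *-distribˡ-+)
open import Data.Nat.DivMod using (_/_; /-congˡ; +-distrib-/-∣ʳ; m<n⇒m/n≡0; m*n/n≡m)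
open import Data.Nat.Divisibility using (_∣_; ∣-refl; ∣-trans; ∣m+n∣m⇒∣n; ∣m∣n⇒∣m+n; ∣m⇒∣m*n; ∣n⇒∣m*n; n∣m*n)
open import Data.Nat.GCD using (gcd)
open import Data.Nat.Coprimality using (Coprime; coprime?; coprime⇒gcd≡1; gcd≡1⇒coprime; coprime-divisor; 1-coprimeTo)
import Data.Nat.Coprimality as Coprime
open import Data.Nat.Tactic.RingSolver using (solve; solve-∀)
open import Data.Integer using (-_; 1ℤ; -1ℤ; _⊖_)
open import Data.Integer.Properties using (pos-*; ^-distribˡ-+-*; [1+m]⊖[1+n]≡m⊖n)
open import Data.List using ([]; _∷_; _++_; length; filter; map; upTo; applyUpTo)
open import Data.List.Properties using (filter-≐; filter-++; length-++; map-applyUpTo)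
open import Data.Product using (_,_; proj₁; proj₂; ∃-syntax)
open import Data.Sum using (inj₁; inj₂)
open import Data.Unit.Polymorphic using (tt)
open import Function using (_∘_; id)
open import Level using (0ℓ)
open import Relation.Nullary using (yes; no; contradiction)
open import Relation.Nullary.Decidable using (True; toWitness; from-no)
open import Relation.Unary using (Pred; Decidable; _≐_; _∩_)
open import Relation.Unary.Polymorphic using (U)
open import Relation.Unary.Properties using (≐-refl; ≐-trans; ≐-sym)
open import Relation.Unary.Algebra using (∩-cong; ∩-idem; ∩-identityˡ; ∩-identityʳ)
open import Relation.Binary.PropositionalEquality using (refl; sym; trans; cong; cong₂; subst; module ≡-Reasoning)

length-filter-applyUpTo-cong : ∀ {P Q : Pred ℕ 0ℓ} {P? : Decidable P} {Q? : Decidable Q} {f g : ℕ → ℕ} →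
  P ∘ f ≐ Q ∘ g → ∀ r → length (filter P? (applyUpTo f r)) ≡ length (filter Q? (applyUpTo g r))
length-filter-applyUpTo-cong _ zero = refl
length-filter-applyUpTo-cong {P? = P?} {Q?} {f} {g} (to , from) (suc r)
  with P? (f 0) | Q? (g 0)
... | yes _ | yes _ = cong suc (length-filter-applyUpTo-cong (to , from) r)
... | no _  | no _  = length-filter-applyUpTo-cong (to , from) r
... | yes p | no ¬q = contradiction (to p) ¬q
... | no ¬p | yes q = contradiction (from q) ¬p

applyUpTo-+ : ∀ {A : Set} (f : ℕ → A) m r → applyUpTo f (m + r) ≡ applyUpTo f m ++ applyUpTo (λ i → f (m + i)) r
applyUpTo-+ f zero r = refl
applyUpTo-+ f (suc m) r = cong (f 0 ∷_) (applyUpTo-+ (f ∘ suc) m r)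

coprime-+-∣ : ∀ {d m} → d ∣ m → Coprime d ∘ (λ i → m + i) ≐ Coprime d
coprime-+-∣ d∣m = (λ c (e∣d , e∣i) → c (e∣d , ∣m∣n⇒∣m+n (∣-trans e∣d d∣m) e∣i))
                , (λ c (e∣d , e∣m+i) → c (e∣d , ∣m+n∣m⇒∣n e∣m+i (∣-trans e∣d d∣m)))

coprime-* : ∀ {m n} → Coprime (m * n) ≐ Coprime m ∩ Coprime n
coprime-* {m} {n} =
    (λ c → (λ (e∣m , e∣i) → c (∣m⇒∣m*n n e∣m , e∣i)) , (λ (e∣n , e∣i) → c (∣n⇒∣m*n m e∣n , e∣i)))
  , (λ (cm , cn) (e∣mn , e∣i) → cn (coprime-divisor (λ (f∣e , f∣m) → cm (f∣m , ∣-trans f∣e e∣i)) e∣mn , e∣i))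

coprime-1 : Coprime 1 ≐ U {ℓ = 0ℓ}
coprime-1 = (λ _ → tt) , (λ _ → 1-coprimeTo _)

coprime-^ : ∀ m k → Coprime (m ^ suc k) ≐ Coprime m
coprime-^ m zero    = ≐-trans coprime-* (≐-trans (∩-cong ≐-refl coprime-1) (∩-identityʳ _))
coprime-^ m (suc k) = ≐-trans coprime-* (≐-trans (∩-cong ≐-refl (coprime-^ m k)) (∩-idem _))

coprime-^*^ : ∀ m n a b → Coprime (m ^ suc a * n ^ suc b) ≐ Coprime (m * n)
coprime-^*^ m n a b = ≐-trans coprime-* (≐-trans (∩-cong (coprime-^ m a) (coprime-^ n b)) (≐-sym coprime-*))

coprime-^*1 : ∀ m a → Coprime (m ^ suc a * 1) ≐ Coprime m
coprime-^*1 m a = ≐-trans coprime-* (≐-trans (∩-cong (coprime-^ m a) coprime-1) (∩-identityʳ _))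

coprime-1*^ : ∀ n b → Coprime (1 * n ^ suc b) ≐ Coprime n
coprime-1*^ n b = ≐-trans coprime-* (≐-trans (∩-cong coprime-1 (coprime-^ n b)) (∩-identityˡ _))

coprimeCount : ℕ → ℕ → ℕ
coprimeCount d m = length (filter (coprime? d) (applyUpTo suc m))

coprimeCount-cong : ∀ {n d} → Coprime n ≐ Coprime d → ∀ m → coprimeCount n m ≡ coprimeCount d m
coprimeCount-cong (to , from) = length-filter-applyUpTo-cong (to , from)

coprimeCount-+ : ∀ {d m} → d ∣ m → ∀ r → coprimeCount d (m + r) ≡ coprimeCount d m + coprimeCount d r
coprimeCount-+ {d} {m} d∣m r = begin
  length (filter (coprime? d) (applyUpTo suc (m + r)))
    ≡⟨ cong (length ∘ filter (coprime? d)) (applyUpTo-+ suc m r) ⟩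
  length (filter (coprime? d) (applyUpTo suc m ++ applyUpTo (λ i → suc (m + i)) r))
    ≡⟨ cong length (filter-++ (coprime? d) (applyUpTo suc m) _) ⟩
  length (filter (coprime? d) (applyUpTo suc m) ++ filter (coprime? d) (applyUpTo (λ i → suc (m + i)) r))
    ≡⟨ length-++ (filter (coprime? d) (applyUpTo suc m)) ⟩
  coprimeCount d m + length (filter (coprime? d) (applyUpTo (λ i → suc (m + i)) r))
    ≡⟨ cong (λ x → coprimeCount d m + x) (length-filter-applyUpTo-cong periodic r) ⟩
  coprimeCount d m + coprimeCount d r ∎
  where
  open ≡-Reasoning
  periodic : Coprime d ∘ (λ i → suc (m + i)) ≐ Coprime d ∘ suc
  periodic = (λ {i} → proj₁ (coprime-+-∣ d∣m) ∘ subst (Coprime d) (sym (+-suc m i)))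
           , (λ {i} → subst (Coprime d) (+-suc m i) ∘ proj₂ (coprime-+-∣ d∣m))

coprimeCount-* : ∀ d k → coprimeCount d (k * d) ≡ k * coprimeCount d d
coprimeCount-* d zero    = refl
coprimeCount-* d (suc k) = trans (coprimeCount-+ ∣-refl (k * d)) (cong (λ x → coprimeCount d d + x) (coprimeCount-* d k))

coprimeCount-*-+ : ∀ d k r → coprimeCount d (k * d + r) ≡ k * coprimeCount d d + coprimeCount d r
coprimeCount-*-+ d k r = trans (coprimeCount-+ (n∣m*n k) r) (cong (_+ coprimeCount d r) (coprimeCount-* d k))

coprimeCount-6[3*m]≡m : ∀ m → coprimeCount 6 (3 * m) ≡ m
coprimeCount-6[3*m]≡m 0             = refl
coprimeCount-6[3*m]≡m 1             = refl
coprimeCount-6[3*m]≡m (suc (suc m)) = begin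
  coprimeCount 6 (3 * (2 + m))      ≡⟨ cong (coprimeCount 6) (*-distribˡ-+ 3 2 m) ⟩
  coprimeCount 6 (6 + 3 * m)        ≡⟨ coprimeCount-+ {6} ∣-refl (3 * m) ⟩
  2 + coprimeCount 6 (3 * m)        ≡⟨ cong (λ x → 2 + x) (coprimeCount-6[3*m]≡m m) ⟩
  2 + m                             ∎
  where open ≡-Reasoning

[r+q*n]/n≡q : ∀ r q n .{{_ : NonZero n}} → r < n → (r + q * n) / n ≡ q
[r+q*n]/n≡q r q n r<n = begin
  (r + q * n) / n     ≡⟨ +-distrib-/-∣ʳ r (n∣m*n q) ⟩
  r / n + q * n / n   ≡⟨ cong₂ _+_ (m<n⇒m/n≡0 r<n) (m*n/n≡m q n) ⟩
  q                   ∎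
  where open ≡-Reasoning

φ≡coprimeCount : ∀ e .{{_ : NonZero e}} n → φ e n ≡ coprimeCount n (n / e)
φ≡coprimeCount e n = begin
  length (filter (λ i → gcd i n ≟ 1) (map suc (upTo (n / e))))
    ≡⟨ cong (length ∘ filter _) (map-applyUpTo id suc (n / e)) ⟩
  length (filter (λ i → gcd i n ≟ 1) (applyUpTo suc (n / e)))
    ≡⟨ cong length (filter-≐ _ (coprime? n) gcd≡1≐Coprime (applyUpTo suc (n / e))) ⟩
  coprimeCount n (n / e) ∎
  where
  open ≡-Reasoning
  gcd≡1≐Coprime : (λ i → gcd i n ≡ 1) ≐ Coprime n
  gcd≡1≐Coprime = Coprime.sym ∘ gcd≡1⇒coprime , coprime⇒gcd≡1 ∘ Coprime.sym

φ≡coprimeCount-rad : ∀ {e n d} r m .{{_ : NonZero e}} {r<e : True (r <? e)} →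
                     Coprime n ≐ Coprime d → n ≡ r + m * e → φ e n ≡ coprimeCount d m
φ≡coprimeCount-rad {e} {n} {d} r m {r<e} n≐d n≡ = begin
  φ e n                    ≡⟨ φ≡coprimeCount e n ⟩
  coprimeCount n (n / e)   ≡⟨ coprimeCount-cong n≐d (n / e) ⟩
  coprimeCount d (n / e)   ≡⟨ cong (coprimeCount d) (trans (/-congˡ n≡) ([r+q*n]/n≡q r m e (toWitness r<e))) ⟩
  coprimeCount d m         ∎
  where open ≡-Reasoning

[1+k]^b≡[-1]^b-mod-[2+k] : ∀ k b → ∃[ q ] ((1 + k) ^ b ≡ q * (2 + k) + 1 × neg1^ b ≡ 1ℤ
                                         ⊎ (1 + k) ^ b ≡ q * (2 + k) + (1 + k) × neg1^ b ≡ -1ℤ)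
[1+k]^b≡[-1]^b-mod-[2+k] k zero = 0 , inj₁ (refl , refl)
[1+k]^b≡[-1]^b-mod-[2+k] k (suc b) with [1+k]^b≡[-1]^b-mod-[2+k] k b
... | q , inj₁ (≡1 , even) =
  q * (1 + k) , inj₂ (trans (cong ((1 + k) *_) ≡1) (solve (k ∷ q ∷ [])) , cong (-1ℤ *ℤ_) even)
... | q , inj₂ (≡-1 , odd) =
  q * (1 + k) + k , inj₁ (trans (cong ((1 + k) *_) ≡-1) (solve (k ∷ q ∷ [])) , cong (-1ℤ *ℤ_) odd)

neg1^-+ : ∀ k b {s} → neg1^ b ≡ s → neg1^ (k + b) ≡ neg1^ k *ℤ s
neg1^-+ k b refl = ^-distribˡ-+-* -1ℤ k b

-- c is passed through the equation c ≡ v only so that Agda can infer it: + k *ℤ + c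
-- computes, and unifying against it directly gets stuck.
*-pos≡pos+1 : ∀ k {c v X s} → c ≡ v → s ≡ 1ℤ → k * v ≡ X + 1 → + k *ℤ + c ≡ + X +ℤ s
*-pos≡pos+1 k {c} refl refl k*c≡X+1 = trans (sym (pos-* k c)) (cong +_ k*c≡X+1)

*-pos≡pos-1 : ∀ k {c v X s} → c ≡ v → s ≡ -1ℤ → k * v + 1 ≡ X → + k *ℤ + c ≡ + X +ℤ s
*-pos≡pos-1 k {c} refl refl refl = sym (begin
  (k * c + 1) ⊖ 1   ≡⟨ cong (_⊖ 1) (+-comm (k * c) 1) ⟩
  suc (k * c) ⊖ 1   ≡⟨ [1+m]⊖[1+n]≡m⊖n (k * c) 0 ⟩
  + (k * c)         ≡⟨ pos-* k c ⟩
  + k *ℤ + c        ∎)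
  where open ≡-Reasoning

φ₁₂[3^[3+b]] : ∀ b → + 2 *ℤ + φ 12 (2 ^ 0 * 3 ^ (3 + b)) ≡ + (3 ^ suc b) -ℤ neg1^ (3 + b)
φ₁₂[3^[3+b]] b with [1+k]^b≡[-1]^b-mod-[2+k] 2 b
... | q , inj₁ (3^b≡ , even) = *-pos≡pos+1 2 φ≡ (cong -_ (neg1^-+ 3 b even)) (begin
  2 * (3 * q * 2 + 2)  ≡⟨ solve (q ∷ []) ⟩
  3 * (q * 4 + 1) + 1  ≡⟨ cong (λ x → 3 * x + 1) 3^b≡ ⟨
  3 ^ suc b + 1        ∎)
  where
  open ≡-Reasoning
  n≡ : 2 ^ 0 * 3 ^ (3 + b) ≡ 3 + (3 * q * 3 + 2) * 12
  n≡ = trans (cong (λ x → 1 * (3 * (3 * (3 * x)))) 3^b≡) (solve (q ∷ []))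
  φ≡ : φ 12 (2 ^ 0 * 3 ^ (3 + b)) ≡ 3 * q * 2 + 2
  φ≡ = trans (φ≡coprimeCount-rad 3 (3 * q * 3 + 2) (coprime-1*^ 3 (2 + b)) n≡) (coprimeCount-*-+ 3 (3 * q) 2)
... | q , inj₂ (3^b≡ , odd) = *-pos≡pos-1 2 φ≡ (cong -_ (neg1^-+ 3 b odd)) (begin
  2 * ((3 * q + 2) * 2 + 0) + 1  ≡⟨ solve (q ∷ []) ⟩
  3 * (q * 4 + 3)                ≡⟨ cong (3 *_) 3^b≡ ⟨
  3 ^ suc b                      ∎)
  where
  open ≡-Reasoning
  n≡ : 2 ^ 0 * 3 ^ (3 + b) ≡ 9 + ((3 * q + 2) * 3 + 0) * 12
  n≡ = trans (cong (λ x → 1 * (3 * (3 * (3 * x)))) 3^b≡) (solve (q ∷ []))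
  φ≡ : φ 12 (2 ^ 0 * 3 ^ (3 + b)) ≡ (3 * q + 2) * 2 + 0
  φ≡ = trans (φ≡coprimeCount-rad 9 ((3 * q + 2) * 3 + 0) (coprime-1*^ 3 (2 + b)) n≡) (coprimeCount-*-+ 3 (3 * q + 2) 0)

φ₁₂[2*3^[2+b]] : ∀ b → + 2 *ℤ + φ 12 (2 ^ 1 * 3 ^ (2 + b)) ≡ + (3 ^ b) -ℤ neg1^ (3 + b)
φ₁₂[2*3^[2+b]] b with [1+k]^b≡[-1]^b-mod-[2+k] 2 b
... | q , inj₁ (3^b≡ , even) = *-pos≡pos+1 2 φ≡ (cong -_ (neg1^-+ 3 b even)) (begin
  2 * (q * 2 + 1)  ≡⟨ solve (q ∷ []) ⟩
  q * 4 + 1 + 1    ≡⟨ cong (_+ 1) 3^b≡ ⟨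
  3 ^ b + 1        ∎)
  where
  open ≡-Reasoning
  n≡ : 2 ^ 1 * 3 ^ (2 + b) ≡ 6 + (q * 6 + 1) * 12
  n≡ = trans (cong (λ x → 2 * 1 * (3 * (3 * x))) 3^b≡) (solve (q ∷ []))
  φ≡ : φ 12 (2 ^ 1 * 3 ^ (2 + b)) ≡ q * 2 + 1
  φ≡ = trans (φ≡coprimeCount-rad 6 (q * 6 + 1) (coprime-^*^ 2 3 0 (1 + b)) n≡) (coprimeCount-*-+ 6 q 1)
... | q , inj₂ (3^b≡ , odd) = *-pos≡pos-1 2 φ≡ (cong -_ (neg1^-+ 3 b odd)) (begin
  2 * (q * 2 + 1) + 1  ≡⟨ solve (q ∷ []) ⟩
  q * 4 + 3            ≡⟨ 3^b≡ ⟨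
  3 ^ b                ∎)
  where
  open ≡-Reasoning
  n≡ : 2 ^ 1 * 3 ^ (2 + b) ≡ 6 + (q * 6 + 4) * 12
  n≡ = trans (cong (λ x → 2 * 1 * (3 * (3 * x))) 3^b≡) (solve (q ∷ []))
  φ≡ : φ 12 (2 ^ 1 * 3 ^ (2 + b)) ≡ q * 2 + 1
  φ≡ = trans (φ≡coprimeCount-rad 6 (q * 6 + 4) (coprime-^*^ 2 3 0 (1 + b)) n≡) (coprimeCount-*-+ 6 q 4)

φ₁₂[2^[2+a]*3^[2+b]] : ∀ a b → φ 12 (2 ^ (2 + a) * 3 ^ (2 + b)) ≡ 2 ^ a * 3 ^ b
φ₁₂[2^[2+a]*3^[2+b]] a b = begin
  φ 12 (2 ^ (2 + a) * 3 ^ (2 + b))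
    ≡⟨ φ≡coprimeCount-rad 0 (3 * (2 ^ a * 3 ^ b)) (coprime-^*^ 2 3 (1 + a) (1 + b)) (n≡ (2 ^ a) (3 ^ b)) ⟩
  coprimeCount 6 (3 * (2 ^ a * 3 ^ b))
    ≡⟨ coprimeCount-6[3*m]≡m (2 ^ a * 3 ^ b) ⟩
  2 ^ a * 3 ^ b ∎
  where
  open ≡-Reasoning
  n≡ : ∀ x y → 2 * (2 * x) * (3 * (3 * y)) ≡ 0 + 3 * (x * y) * 12
  n≡ = solve-∀

φ₁₂[2^[4+a]] : ∀ a → + 3 *ℤ + φ 12 (2 ^ (4 + a) * 3 ^ 0) ≡ + (2 ^ suc a) +ℤ neg1^ (4 + a)
φ₁₂[2^[4+a]] a with [1+k]^b≡[-1]^b-mod-[2+k] 1 a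
... | q , inj₁ (2^a≡ , even) = *-pos≡pos+1 3 φ≡ (neg1^-+ 4 a even) (begin
  3 * (2 * q * 1 + 1)  ≡⟨ solve (q ∷ []) ⟩
  2 * (q * 3 + 1) + 1  ≡⟨ cong (λ x → 2 * x + 1) 2^a≡ ⟨
  2 ^ suc a + 1        ∎)
  where
  open ≡-Reasoning
  n≡ : 2 ^ (4 + a) * 3 ^ 0 ≡ 4 + (2 * q * 2 + 1) * 12
  n≡ = trans (cong (λ x → 2 * (2 * (2 * (2 * x))) * 1) 2^a≡) (solve (q ∷ []))
  φ≡ : φ 12 (2 ^ (4 + a) * 3 ^ 0) ≡ 2 * q * 1 + 1
  φ≡ = trans (φ≡coprimeCount-rad 4 (2 * q * 2 + 1) (coprime-^*1 2 (3 + a)) n≡) (coprimeCount-*-+ 2 (2 * q) 1)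
... | q , inj₂ (2^a≡ , odd) = *-pos≡pos-1 3 φ≡ (neg1^-+ 4 a odd) (begin
  3 * ((2 * q + 1) * 1 + 0) + 1  ≡⟨ solve (q ∷ []) ⟩
  2 * (q * 3 + 2)                ≡⟨ cong (2 *_) 2^a≡ ⟨
  2 ^ suc a                      ∎)
  where
  open ≡-Reasoning
  n≡ : 2 ^ (4 + a) * 3 ^ 0 ≡ 8 + ((2 * q + 1) * 2 + 0) * 12
  n≡ = trans (cong (λ x → 2 * (2 * (2 * (2 * x))) * 1) 2^a≡) (solve (q ∷ []))
  φ≡ : φ 12 (2 ^ (4 + a) * 3 ^ 0) ≡ (2 * q + 1) * 1 + 0
  φ≡ = trans (φ≡coprimeCount-rad 8 ((2 * q + 1) * 2 + 0) (coprime-^*1 2 (3 + a)) n≡) (coprimeCount-*-+ 2 (2 * q + 1) 0)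

φ₁₂[2^[4+a]*3] : ∀ a → + 3 *ℤ + φ 12 (2 ^ (4 + a) * 3 ^ 1) ≡ + (2 ^ (2 + a)) +ℤ neg1^ (5 + a)
φ₁₂[2^[4+a]*3] a with [1+k]^b≡[-1]^b-mod-[2+k] 1 a
... | q , inj₁ (2^a≡ , even) = *-pos≡pos-1 3 φ≡ (neg1^-+ 5 a even) (begin
  3 * (2 * q * 2 + 1) + 1  ≡⟨ solve (q ∷ []) ⟩
  2 * (2 * (q * 3 + 1))    ≡⟨ cong (λ x → 2 * (2 * x)) 2^a≡ ⟨
  2 ^ (2 + a)              ∎)
  where
  open ≡-Reasoning
  n≡ : 2 ^ (4 + a) * 3 ^ 1 ≡ 0 + (2 * q * 6 + 4) * 12
  n≡ = trans (cong (λ x → 2 * (2 * (2 * (2 * x))) * (3 * 1)) 2^a≡) (solve (q ∷ []))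
  φ≡ : φ 12 (2 ^ (4 + a) * 3 ^ 1) ≡ 2 * q * 2 + 1
  φ≡ = trans (φ≡coprimeCount-rad 0 (2 * q * 6 + 4) (coprime-^*^ 2 3 (3 + a) 0) n≡) (coprimeCount-*-+ 6 (2 * q) 4)
... | q , inj₂ (2^a≡ , odd) = *-pos≡pos+1 3 φ≡ (neg1^-+ 5 a odd) (begin
  3 * ((2 * q + 1) * 2 + 1)  ≡⟨ solve (q ∷ []) ⟩
  2 * (2 * (q * 3 + 2)) + 1  ≡⟨ cong (λ x → 2 * (2 * x) + 1) 2^a≡ ⟨
  2 ^ (2 + a) + 1            ∎)
  where
  open ≡-Reasoning
  n≡ : 2 ^ (4 + a) * 3 ^ 1 ≡ 0 + ((2 * q + 1) * 6 + 2) * 12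
  n≡ = trans (cong (λ x → 2 * (2 * (2 * (2 * x))) * (3 * 1)) 2^a≡) (solve (q ∷ []))
  φ≡ : φ 12 (2 ^ (4 + a) * 3 ^ 1) ≡ (2 * q + 1) * 2 + 1
  φ≡ = trans (φ≡coprimeCount-rad 0 ((2 * q + 1) * 6 + 2) (coprime-^*^ 2 3 (3 + a) 0) n≡) (coprimeCount-*-+ 6 (2 * q + 1) 2)

φ₁₂-α≤1 : ∀ α β → 12 < 2 ^ α * 3 ^ β → α ≡ 0 ⊎ (α ≡ 1 × 2 ≤ β) →
          + 2 *ℤ + φ 12 (2 ^ α * 3 ^ β) ≡ + (3 ^ (β ∸ 2)) -ℤ neg1^ (α + β)
φ₁₂-α≤1 0 (suc (suc (suc b))) _ _ = φ₁₂[3^[3+b]] b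
φ₁₂-α≤1 1 (suc (suc b))       _ _ = φ₁₂[2*3^[2+b]] b
φ₁₂-α≤1 0 0 12<n _ = contradiction 12<n (from-no (12 <? 1))
φ₁₂-α≤1 0 1 12<n _ = contradiction 12<n (from-no (12 <? 3))
φ₁₂-α≤1 0 2 12<n _ = contradiction 12<n (from-no (12 <? 9))
φ₁₂-α≤1 1 0 _ (inj₂ (_ , ()))
φ₁₂-α≤1 1 1 _ (inj₂ (_ , s≤s ()))
φ₁₂-α≤1 (suc (suc _)) _ _ (inj₂ (() , _))

φ₁₂-2≤α-2≤β : ∀ α β → 2 ≤ α → 2 ≤ β → φ 12 (2 ^ α * 3 ^ β) ≡ 2 ^ (α ∸ 2) * 3 ^ (β ∸ 2)
φ₁₂-2≤α-2≤β (suc (suc a)) (suc (suc b)) _ _ = φ₁₂[2^[2+a]*3^[2+b]] a b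
φ₁₂-2≤α-2≤β 1 _ (s≤s ()) _
φ₁₂-2≤α-2≤β _ 1 _ (s≤s ())

φ₁₂-4≤α-β≤1 : ∀ α β → 4 ≤ α → β ≤ 1 →
              + 3 *ℤ + φ 12 (2 ^ α * 3 ^ β) ≡ + (2 ^ (α + β ∸ 3)) +ℤ neg1^ (α + β)
φ₁₂-4≤α-β≤1 (suc (suc (suc (suc a)))) 0 _ _ rewrite +-identityʳ a = φ₁₂[2^[4+a]] a
φ₁₂-4≤α-β≤1 (suc (suc (suc (suc a)))) 1 _ _ rewrite +-comm a 1 = φ₁₂[2^[4+a]*3] a
φ₁₂-4≤α-β≤1 1 _ (s≤s ()) _
φ₁₂-4≤α-β≤1 2 _ (s≤s (s≤s ())) _
φ₁₂-4≤α-β≤1 3 _ (s≤s (s≤s (s≤s ()))) _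
φ₁₂-4≤α-β≤1 _ (suc (suc _)) _ (s≤s ())

theorem4p1 : (α β : ℕ) → 12 < 2 ^ α * 3 ^ β → 2 ^ α * 3 ^ β ≢ 24 →
    ((α ≡ 0 ⊎ (α ≡ 1 × 2 ≤ β)) →
      + 2 *ℤ + φ 12 (2 ^ α * 3 ^ β) ≡ + (3 ^ (β ∸ 2)) -ℤ neg1^ (α + β))
    × (2 ≤ α → 2 ≤ β → φ 12 (2 ^ α * 3 ^ β) ≡ 2 ^ (α ∸ 2) * 3 ^ (β ∸ 2))
    × (4 ≤ α → β ≤ 1 →
      + 3 *ℤ + φ 12 (2 ^ α * 3 ^ β) ≡ + (2 ^ (α + β ∸ 3)) +ℤ neg1^ (α + β))
theorem4p1 α β 12<n _ = φ₁₂-α≤1 α β 12<n , φ₁₂-2≤α-2≤β α β , φ₁₂-4≤α-β≤1 α β
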